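{- Let $k,d \in \mathbb{N}$ and let $\beta$ be a scheme for $T_{k,d}$. If $I = (D,k,\mathcal{T})$ is a yes-instance of DAG Disjoint Paths, then $J_{k,d}(I,\beta)$ is a yes-instance as well.
   Context: An instance $I=(D,k,\mathcal{T})$ of DAG Disjoint Paths consists of an acyclic digraph $D$ and $k$ requests $(s_i,t_i)\in V(D)^2$, $i\in[k]$; it is a yes-instance if there exist pairwise vertex-disjoint paths $P_1,\dots,P_k$ in $D$ with $P_i$ an $(s_i,t_i)$-path, and a no-instance otherwise. $T_{k,d}$ is the full $k$-ary rooted tree of depth $d$ (the root has depth $0$, leaves have depth $d$, so it has $k^d$ leaves). $L(T)$ is the set of leaves of a rooted tree $T$, and $T^v_{k,d}$ is the subtree of $T_{k,d}$ rooted at $v$. A scheme for $T_{k,d}$ is a collection $\beta=(f_v)_{v\in V(T_{k,d})}$ where each $f_v$ is a bijection from $L(T^v_{k,d})$ to $\{1,\dots,|L(T^v_{k,d})|\}$. The instance $J_{k,d}(I,\beta)=(D',k^d,\mathcal{T}')$, whose requests are indexed by the leaves of $T_{k,d}$ as $(s_v,t_v)_{v\in L(T_{k,d})}$, is defined recursively. If $d=1$, $J_{k,1}(I,\beta)=I$, with the requests of $I$ indexed by the $k$ leaves of $T_{k,1}$ in an arbitrary order. If $d>1$, let $u_1,\dots,u_k$ be the children of the root; let $\beta_i$ be the restriction of $\beta$ to the nodes of $T^{u_i}_{k,d}$ (a copy of $T_{k,d-1}$) and $J_i=J_{k,d-1}(I,\beta_i)$, whose requests are indexed by the leaves of $T^{u_i}_{k,d}$.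 Take the disjoint union of $J_1,\dots,J_k$ and $k^{d-1}$ copies $I_1,\dots,I_{k^{d-1}}$ of $I$; write $I_j[x]$ for the copy in $I_j$ of a vertex $x$ of $D$ and $J_i[s_v],J_i[t_v]$ for the endpoints of request $v$ of $J_i$. For each $i\in[k]$ and each leaf $v$ of $T^{u_i}_{k,d}$, add an arc from $J_i[t_v]$ to $I_{f_{u_i}(v)}[s_i]$, and add the request $(J_i[s_v],\, I_{f_{u_i}(v)}[t_i])$ to $\mathcal{T}'$, indexed by the leaf $v$ (viewed as a leaf of $T_{k,d}$). The resulting digraph $D'$ is acyclic. -}

module Defs where

open import Data.Nat using (ℕ; zero; suc; _≤_; _∸_; _^_; z≤n; s≤s)
open import Data.Fin using (Fin)
open import Data.Vec using (Vec; []; _∷_)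
open import Data.Bool using (Bool; T)
open import Data.Empty using (⊥)
open import Data.Sum using (_⊎_; inj₁; inj₂)
open import Data.Product using (Σ; Σ-syntax; _×_; _,_; proj₁; proj₂)
open import Data.List using (List; []; _∷_)
open import Data.List.Membership.Propositional using (_∈_)
open import Data.List.Relation.Unary.Unique.Propositional using (Unique)
open import Relation.Binary.PropositionalEquality using (_≡_; _≢_)
open import Function.Bundles using (_⤖_; Bijection)

record Digraph : Set₁ where
  field
    V   : Set
    Arc : V → V → Set
open Digraph public

data Walk (G : Digraph) : V G → V G → Set where
  stop : (x : V G) → Walk G x x
  step : (x : V G) {y z : V G} → Arc G x y → Walk G y z → Walk G x z

verts : {G : Digraph} {x y : V G} → Walk G x y → List (V G)
verts (stop x)     = x ∷ []
verts (step x _ w) = x ∷ verts w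

IsPath : {G : Digraph} {x y : V G} → Walk G x y → Set
IsPath w = Unique (verts w)

Acyclic : Digraph → Set
Acyclic G = (x y : V G) → Arc G x y → Walk G y x → ⊥

IsYes : (G : Digraph) {R : Set} → (R → V G × V G) → Set
IsYes G {R} req =
  Σ[ P ∈ ((r : R) → Walk G (proj₁ (req r)) (proj₂ (req r))) ]
    (((r : R) → IsPath (P r)) ×
     ((r r' : R) → r ≢ r' → (x : V G) → x ∈ verts (P r) → x ∈ verts (P r') → ⊥))

record Instance (k : ℕ) : Set where
  field
    n   : ℕ
    arc : Fin n → Fin n → Bool
    src : Fin k → Fin n
    tgt : Fin k → Fin n
open Instance public

digraph : {k : ℕ} → Instance k → Digraph
digraph I = record { V = Fin (n I) ; Arc = λ x y → T (arc I x y) }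

requests : {k : ℕ} (I : Instance k) → Fin k → Fin (n I) × Fin (n I)
requests I i = src I i , tgt I i

IsDAGInstance : {k : ℕ} → Instance k → Set
IsDAGInstance I = Acyclic (digraph I)

-- Full k-ary tree T_{k,D}: a node of depth m ≤ D is a word in Vec (Fin k) m
-- (the sequence of child indices from the root); the leaves of the subtree
-- rooted at a node v of depth m are v ++ w for w : Vec (Fin k) (D ∸ m),
-- identified with the suffix w.

Scheme : ℕ → ℕ → Set
Scheme k D = (m : ℕ) → m ≤ D → (v : Vec (Fin k) m) →
             Vec (Fin k) (D ∸ m) ⤖ Fin (k ^ (D ∸ m))

restrict : {k D : ℕ} → Scheme k (suc D) → Fin k → Scheme k D
restrict β i m m≤D v = β (suc m) (s≤s m≤D) (i ∷ v)

fChild : {k D : ℕ} → Scheme k (suc D) → (i : Fin k) →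
         Vec (Fin k) D → Fin (k ^ D)
fChild β i = Bijection.to (β 1 (s≤s z≤n) (i ∷ []))

-- The instance J_{k,d}(I, β), here with d = suc e (d ≥ 1).

module _ {k : ℕ} (I : Instance k) where

  -- vertex set of J_{k, suc e}: k copies of J_{k,e} plus k^e copies of I
  JV : ℕ → Set
  JV zero    = Fin (n I)
  JV (suc e) = (Fin k × JV e) ⊎ (Fin (k ^ suc e) × Fin (n I))

  JReq : (e : ℕ) → Scheme k (suc e) → Vec (Fin k) (suc e) → JV e × JV e
  JReq zero    β (i ∷ [])  = src I i , tgt I i
  JReq (suc e) β (i ∷ w)   =
    inj₁ (i , proj₁ (JReq e (restrict β i) w)) ,
    inj₂ (fChild β i w , tgt I i)

  JArc : (e : ℕ) → Scheme k (suc e) → JV e → JV e → Set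
  JArc zero    β x y = T (arc I x y)
  JArc (suc e) β (inj₁ (i , x)) (inj₁ (j , y)) = i ≡ j × JArc e (restrict β i) x y
  JArc (suc e) β (inj₂ (a , x)) (inj₂ (b , y)) = a ≡ b × T (arc I x y)
  JArc (suc e) β (inj₁ (i , x)) (inj₂ (a , y)) =
    Σ[ w ∈ Vec (Fin k) (suc e) ]
      (x ≡ proj₂ (JReq e (restrict β i) w) × a ≡ fChild β i w × y ≡ src I i)
  JArc (suc e) β (inj₂ _) (inj₁ _) = ⊥

  JDigraph : (e : ℕ) → Scheme k (suc e) → Digraph
  JDigraph e β = record { V = JV e ; Arc = JArc e β }

module Submission where

open import Defs
open import Data.Nat using (ℕ; zero; suc; _^_; s≤s; z≤n)
open import Data.Fin using (Fin)
open import Data.Fin.Properties using (_≟_)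
open import Data.Vec using (Vec; []; _∷_)
open import Data.Empty using (⊥)
open import Data.Sum using (_⊎_; inj₁; inj₂)
open import Data.Sum.Properties using (inj₁-injective; inj₂-injective)
open import Data.Product using (∃; _×_; _,_; proj₁; proj₂)
open import Data.Product.Properties using (×-≡,≡←≡)
open import Data.List using (List; _∷_; map; _++_)
open import Data.List.Membership.Propositional using (_∈_)
open import Data.List.Membership.Propositional.Properties using (∈-map⁻; ∈-++⁻)
open import Data.List.Relation.Unary.Unique.Propositional using (Unique)
open import Data.List.Relation.Unary.Unique.Propositional.Properties using (map⁺; ++⁺)
open import Relation.Binary.PropositionalEquality
  using (_≡_; _≢_; refl; cong; cong₂; subst; sym; trans)
open import Relation.Nullary using (yes; no)
open import Function using (_∘_)
open import Function.Bundles using (Bijection)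

-- Route the request of leaf i ∷ w of J_{k,d+1} along its own solution in the
-- i-th copy of J_{k,d}, then across the added arc into the copy I_{f(w)},
-- and finally along the path P_i of the given solution of I.  Routes in
-- different copies of J_{k,d} only meet in copies of I, and there two of
-- them meet only if they use distinct paths P_i ≠ P_j of one copy of I,
-- which are disjoint; routes from the same copy J_i use distinct copies of I
-- because f_{u_i} is injective.

module _ {G H : Digraph} (f : V G → V H)
         (f-arc : ∀ {x y} → Arc G x y → Arc H (f x) (f y)) where

  mapWalk : {x y : V G} → Walk G x y → Walk H (f x) (f y)
  mapWalk (stop x)     = stop (f x)
  mapWalk (step x a w) = step (f x) (f-arc a) (mapWalk w)

  verts-mapWalk : {x y : V G} (w : Walk G x y) → verts (mapWalk w) ≡ map f (verts w)
  verts-mapWalk (stop x)     = refl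
  verts-mapWalk (step x a w) = cong (f x ∷_) (verts-mapWalk w)

joinWalk : {G : Digraph} {x y z u : V G} →
           Walk G x y → Arc G y z → Walk G z u → Walk G x u
joinWalk (stop x)     a w = step x a w
joinWalk (step x b v) a w = step x b (joinWalk v a w)

verts-joinWalk : {G : Digraph} {x y z u : V G}
                 (v : Walk G x y) (a : Arc G y z) (w : Walk G z u) →
                 verts (joinWalk v a w) ≡ verts v ++ verts w
verts-joinWalk (stop x)     a w = refl
verts-joinWalk (step x b v) a w = cong (x ∷_) (verts-joinWalk v a w)

module _ {A B C : Set} {f : A → C} {g : B → C} where

  ∈-map-++-map⁻ : (xs : List A) {ys : List B} {z : C} →
                  z ∈ map f xs ++ map g ys →
                  (∃ λ x → x ∈ xs × z ≡ f x) ⊎ (∃ λ y → y ∈ ys × z ≡ g y)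
  ∈-map-++-map⁻ xs z∈ with ∈-++⁻ (map f xs) z∈
  ... | inj₁ z∈f = inj₁ (∈-map⁻ f z∈f)
  ... | inj₂ z∈g = inj₂ (∈-map⁻ g z∈g)

  unique-map-++-map : (∀ {x x'} → f x ≡ f x' → x ≡ x') →
                      (∀ {y y'} → g y ≡ g y' → y ≡ y') →
                      (∀ x y → f x ≢ g y) →
                      {xs : List A} {ys : List B} → Unique xs → Unique ys →
                      Unique (map f xs ++ map g ys)
  unique-map-++-map f-inj g-inj f≢g {xs} {ys} xs! ys! =
    ++⁺ (map⁺ f-inj xs!) (map⁺ g-inj ys!) disjoint
    where
    disjoint : ∀ {z} → z ∈ map f xs × z ∈ map g ys → ⊥
    disjoint (z∈f , z∈g) with ∈-map⁻ f z∈f | ∈-map⁻ g z∈g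
    ... | x , _ , refl | y , _ , fx≡gy = f≢g x y fx≡gy

fChild-injective : {k D : ℕ} (β : Scheme k (suc D)) (i : Fin k) {w w' : Vec (Fin k) D} →
                   fChild β i w ≡ fChild β i w' → w ≡ w'
fChild-injective β i = Bijection.injective (β 1 (s≤s z≤n) (i ∷ []))

module _ {k : ℕ} (I : Instance k) (solution : IsYes (digraph I) (requests I)) where

  private
    P : (i : Fin k) → Walk (digraph I) (src I i) (tgt I i)
    P = proj₁ solution

    P-isPath : (i : Fin k) → IsPath (P i)
    P-isPath = proj₁ (proj₂ solution)

    P-disjoint : (i j : Fin k) → i ≢ j → (x : Fin (n I)) →
                 x ∈ verts (P i) → x ∈ verts (P j) → ⊥
    P-disjoint = proj₂ (proj₂ solution)

  J₁-isYes : (β : Scheme k 1) → IsYes (JDigraph I zero β) (JReq I zero β)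
  J₁-isYes β = Q , Q-isPath , Q-disjoint
    where
    Q : (r : Vec (Fin k) 1) → Walk (JDigraph I zero β) (proj₁ (JReq I zero β r)) (proj₂ (JReq I zero β r))
    Q (i ∷ []) = P i

    Q-isPath : (r : Vec (Fin k) 1) → IsPath (Q r)
    Q-isPath (i ∷ []) = P-isPath i

    Q-disjoint : (r r' : Vec (Fin k) 1) → r ≢ r' → (x : Fin (n I)) →
                 x ∈ verts (Q r) → x ∈ verts (Q r') → ⊥
    Q-disjoint (i ∷ []) (j ∷ []) r≢r' = P-disjoint i j (r≢r' ∘ cong (_∷ []))

  module Step (e : ℕ) (β : Scheme k (suc (suc e)))
              (child-isYes : (i : Fin k) → IsYes (JDigraph I e (restrict β i)) (JReq I e (restrict β i)))
              where

    G : Digraph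
    G = JDigraph I (suc e) β

    Child : Fin k → Digraph
    Child i = JDigraph I e (restrict β i)

    inChild : Fin k → JV I e → JV I (suc e)
    inChild i x = inj₁ (i , x)

    inCopy : Fin (k ^ suc e) → Fin (n I) → JV I (suc e)
    inCopy a x = inj₂ (a , x)

    inChild-arc : (i : Fin k) {x y : JV I e} → Arc (Child i) x y → Arc G (inChild i x) (inChild i y)
    inChild-arc i = refl ,_

    inCopy-arc : (a : Fin (k ^ suc e)) {x y : Fin (n I)} → Arc (digraph I) x y → Arc G (inCopy a x) (inCopy a y)
    inCopy-arc a = refl ,_

    Q : (i : Fin k) (w : Vec (Fin k) (suc e)) →
        Walk (Child i) (proj₁ (JReq I e (restrict β i) w)) (proj₂ (JReq I e (restrict β i) w))
    Q i = proj₁ (child-isYes i)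

    Q-isPath : (i : Fin k) (w : Vec (Fin k) (suc e)) → IsPath (Q i w)
    Q-isPath i = proj₁ (proj₂ (child-isYes i))

    Q-disjoint : (i : Fin k) (w w' : Vec (Fin k) (suc e)) → w ≢ w' → (x : JV I e) →
                 x ∈ verts (Q i w) → x ∈ verts (Q i w') → ⊥
    Q-disjoint i = proj₂ (proj₂ (child-isYes i))

    route : (r : Vec (Fin k) (suc (suc e))) →
            Walk G (proj₁ (JReq I (suc e) β r)) (proj₂ (JReq I (suc e) β r))
    route (i ∷ w) =
      joinWalk (mapWalk {Child i} {G} (inChild i) (inChild-arc i) (Q i w))
               (w , refl , refl , refl)
               (mapWalk {digraph I} {G} (inCopy (fChild β i w)) (inCopy-arc (fChild β i w)) (P i))

    verts-route : (i : Fin k) (w : Vec (Fin k) (suc e)) →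
                  verts (route (i ∷ w)) ≡
                  map (inChild i) (verts (Q i w)) ++ map (inCopy (fChild β i w)) (verts (P i))
    verts-route i w =
      trans (verts-joinWalk {G} _ _ _)
            (cong₂ _++_ (verts-mapWalk {Child i} {G} (inChild i) (inChild-arc i) (Q i w))
                        (verts-mapWalk {digraph I} {G} (inCopy (fChild β i w)) (inCopy-arc (fChild β i w)) (P i)))

    route-isPath : (r : Vec (Fin k) (suc (suc e))) → IsPath (route r)
    route-isPath (i ∷ w) =
      subst Unique (sym (verts-route i w))
        (unique-map-++-map (proj₂ ∘ ×-≡,≡←≡ ∘ inj₁-injective)
                           (proj₂ ∘ ×-≡,≡←≡ ∘ inj₂-injective)
                           (λ _ _ ())
                           (Q-isPath i w) (P-isPath i))

    ∈-route⁻ : (i : Fin k) (w : Vec (Fin k) (suc e)) {x : JV I (suc e)} →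
               x ∈ verts (route (i ∷ w)) →
               (∃ λ y → y ∈ verts (Q i w) × x ≡ inChild i y) ⊎
               (∃ λ y → y ∈ verts (P i) × x ≡ inCopy (fChild β i w) y)
    ∈-route⁻ i w x∈ = ∈-map-++-map⁻ (verts (Q i w)) (subst (_ ∈_) (verts-route i w) x∈)

    route-disjoint : (r r' : Vec (Fin k) (suc (suc e))) → r ≢ r' → (x : JV I (suc e)) →
                     x ∈ verts (route r) → x ∈ verts (route r') → ⊥
    route-disjoint (i ∷ w) (j ∷ w') r≢r' x x∈ x∈' with ∈-route⁻ i w x∈ | ∈-route⁻ j w' x∈'
    ... | inj₁ (y , y∈ , refl) | inj₁ (.y , y∈' , refl) =
      Q-disjoint i w w' (r≢r' ∘ cong (i ∷_)) y y∈ y∈'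
    ... | inj₁ (_ , _ , refl) | inj₂ (_ , _ , ())
    ... | inj₂ (_ , _ , refl) | inj₁ (_ , _ , ())
    ... | inj₂ (y , y∈ , refl) | inj₂ (y' , y∈' , same)
      with i ≟ j | ×-≡,≡←≡ (inj₂-injective same)
    ... | no i≢j    | _ , refl = P-disjoint i j i≢j y y∈ y∈'
    ... | yes refl  | same-copy , _ = r≢r' (cong (i ∷_) (fChild-injective β i same-copy))

    isYes : IsYes G (JReq I (suc e) β)
    isYes = route , route-isPath , route-disjoint

  J-isYes : (e : ℕ) (β : Scheme k (suc e)) → IsYes (JDigraph I e β) (JReq I e β)
  J-isYes zero    β = J₁-isYes β
  J-isYes (suc e) β = Step.isYes e β (λ i → J-isYes e (restrict β i))

mainTheorem3 : (k d : ℕ) (β : Scheme k (suc d)) (I : Instance k) →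
    IsDAGInstance I →
    IsYes (digraph I) (requests I) →
    IsYes (JDigraph I d β) (JReq I d β)
mainTheorem3 k d β I _ solution = J-isYes I solution d β
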